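{- Let $\mathscr{A}$ be a real tensor of order $k$ and dimension $n$, let $\{V_1,\dots,V_m\}$ be an equitable partition of $[n]$ corresponding to $\mathscr{A}$, and let $X$ and $\mathscr{B}$ be the characteristic matrix of this partition and the (equitable) quotient tensor of $\mathscr{A}$ corresponding to it, respectively. If $y\in\mathbb{R}^m$ is an eigenvector of $\mathscr{B}$ corresponding to the $H$-eigenvalue $\lambda$, then $Xy$ is an eigenvector of $\mathscr{A}$ corresponding to $\lambda$.
   Context: For an order $k$ dimension $n$ tensor $\mathscr{T}=(t_{i_1\cdots i_k})$ and $x\in\mathbb{R}^n$, $\mathscr{T}x\in\mathbb{R}^n$ has entries $(\mathscr{T}x)_i=\sum_{i_2,\dots,i_k\in[n]}t_{ii_2\cdots i_k}x_{i_2}\cdots x_{i_k}$, and $x^{[k-1]}=(x_1^{k-1},\dots,x_n^{k-1})^T$. A real number $\lambda$ is an $H$-eigenvalue of $\mathscr{T}$ with eigenvector $x$ if $x\in\mathbb{R}^n$ is nonzero and $\mathscr{T}x=\lambda x^{[k-1]}$. A partition $\{V_1,\dots,V_m\}$ of $[n]$ consists of nonempty pairwise disjoint sets with union $[n]$; its characteristic matrix is the $n\times m$ matrix $X$ with $x_{ij}=1$ if $i\in V_j$ and $0$ otherwise. The quotient tensor of $\mathscr{A}=(a_{i_1\cdots i_k})$ is the order $k$ dimension $m$ tensor $\mathscr{B}$ with $b_{ii_2\cdots i_k}=\frac{1}{|V_i|}\sum_{j\in V_i}\sum_{j_2\in V_{i_2},\dots,j_k\in V_{i_k}}a_{jj_2\cdots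 j_k}$; the partition is equitable corresponding to $\mathscr{A}$ if $\sum_{j_2\in V_{i_2},\dots,j_k\in V_{i_k}}a_{jj_2\cdots j_k}=b_{ii_2\cdots i_k}$ for all $i,i_2,\dots,i_k\in[m]$ and all $j\in V_i$. -}

module Defs where

open import Level using (Level; _⊔_)
open import Data.Nat using (ℕ; zero; suc)
open import Data.Fin using (Fin) renaming (_≟_ to _≟ᶠ_)
open import Data.Vec using (Vec; []; _∷_; map)
open import Data.Vec.Properties using (≡-dec)
open import Data.List using (List; []; _∷_; concatMap; length; filter)
open import Data.List using () renaming (map to lmap)
open import Data.Fin.Base using () renaming (toℕ to toℕ)
open import Data.Product using (_×_; Σ)
open import Function using (Surjective)
open import Relation.Nullary using (¬_; yes; no; Dec)
open import Relation.Binary.PropositionalEquality using (_≡_)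
open import Algebra.Bundles using (CommutativeRing)
import Data.List as L
import Data.Fin as F

-- A field of characteristic zero (ℝ is an instance).  The inverse is a total
-- function, only constrained on nonzero elements.
-- embedding of ℕ : n ↦ n·1
ringFromℕ : ∀ {c ℓ} (R : CommutativeRing c ℓ) → ℕ → CommutativeRing.Carrier R
ringFromℕ R zero    = CommutativeRing.0# R
ringFromℕ R (suc n) = CommutativeRing._+_ R (CommutativeRing.1# R) (ringFromℕ R n)

record CharZeroField (c ℓ : Level) : Set (Level.suc (c ⊔ ℓ)) where
  field
    commRing : CommutativeRing c ℓ
  open CommutativeRing commRing public
  fromℕ : ℕ → Carrier
  fromℕ = ringFromℕ commRing
  field
    _⁻¹      : Carrier → Carrier
    inverseʳ : ∀ x → ¬ (x ≈ 0#) → x * (x ⁻¹) ≈ 1#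
    charZero : ∀ n → ¬ (fromℕ (suc n) ≈ 0#)

allFin : (n : ℕ) → List (Fin n)
allFin n = L.allFin n

allTuples : (k n : ℕ) → List (Vec (Fin n) k)
allTuples zero    n = [] ∷ []
allTuples (suc k) n = concatMap (λ i → lmap (i ∷_) (allTuples k n)) (allFin n)

-- A partition {V₁,…,V_m} of [n] is given by the block map π : [n] → [m]
-- (V_j = π⁻¹(j)); surjectivity of π says every block is nonempty.
record Partition (n m : ℕ) : Set where
  field
    π    : Fin n → Fin m
    surj : Surjective _≡_ _≡_ π


module _ {c ℓ} (𝔽 : CharZeroField c ℓ) where
  open CharZeroField 𝔽

  sumL : List Carrier → Carrier
  sumL = L.foldr _+_ 0#

  Σ[_]_ : ∀ {A : Set} → List A → (A → Carrier) → Carrier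
  Σ[ xs ] f = sumL (lmap f xs)

  _^_ : Carrier → ℕ → Carrier
  x ^ zero  = 1#
  x ^ suc e = x * (x ^ e)

  Vector : ℕ → Set c
  Vector n = Fin n → Carrier

  Tensor : ℕ → ℕ → Set c
  Tensor k n = Vec (Fin n) k → Carrier

  prodVec : ∀ {n k} → Vector n → Vec (Fin n) k → Carrier
  prodVec x []       = 1#
  prodVec x (i ∷ is) = x i * prodVec x is

  _·ᵗ_ : ∀ {k n} → Tensor (suc k) n → Vector n → Vector n
  _·ᵗ_ {k} {n} T x i = Σ[ allTuples k n ] (λ is → T (i ∷ is) * prodVec x is)

  -- x^{[k-1]} for order suc k, i.e. entrywise power k
  _^[_] : ∀ {n} → Vector n → ℕ → Vector n
  (x ^[ e ]) i = x i ^ e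

  NonZero : ∀ {n} → Vector n → Set ℓ
  NonZero {n} x = ¬ (∀ i → x i ≈ 0#)

  IsHEigenpair : ∀ {k n} → Tensor (suc k) n → Carrier → Vector n → Set ℓ
  IsHEigenpair {k} T λ' x = NonZero x × (∀ i → (T ·ᵗ x) i ≈ λ' * (x ^[ k ]) i)

  module _ {n m : ℕ} (P : Partition n m) where
    open Partition P

    charMatrix : Fin n → Fin m → Carrier
    charMatrix i j with π i ≟ᶠ j
    ... | yes _ = 1#
    ... | no  _ = 0#

    blockSize : Fin m → ℕ
    blockSize i = length (filter (λ j → π j ≟ᶠ i) (allFin n))

    blockSum : ∀ {k} → Tensor (suc k) n → Fin n → Vec (Fin m) k → Carrier
    blockSum {k} A j is =
      Σ[ filter (λ js → ≡-dec _≟ᶠ_ (map π js) is) (allTuples k n) ] (λ js → A (j ∷ js))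

    quotientTensor : ∀ {k} → Tensor (suc k) n → Tensor (suc k) m
    quotientTensor A (i ∷ is) =
      (fromℕ (blockSize i)) ⁻¹ *
        (Σ[ filter (λ j → π j ≟ᶠ i) (allFin n) ] (λ j → blockSum A j is))

    IsEquitable : ∀ {k} → Tensor (suc k) n → Set ℓ
    IsEquitable A = ∀ i is (j : Fin n) → π j ≡ i →
      blockSum A j is ≈ quotientTensor A (i ∷ is)

    applyX : Vector m → Vector n
    applyX y i = Σ[ allFin m ] (λ j → charMatrix i j * y j)

-- Let π : [n] → [m] be the block map of the partition, so that the
-- characteristic matrix satisfies (Xy)ᵢ = y_{π i}.  For any tensor 𝒜,
-- grouping the index tuples j₂…j_k according to their block tuple
-- (π j₂, …, π j_k) gives
--     (𝒜(Xy))ᵢ = Σ_{i₂…i_k} blockSum(𝒜, i, i₂…i_k) · y_{i₂} ⋯ y_{i_k}.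
-- If the partition is equitable, every block sum equals the quotient entry
-- b_{π i, i₂ … i_k}, so (𝒜(Xy))ᵢ = (ℬy)_{π i} = λ y_{π i}^{k-1} = λ (Xy)ᵢ^{k-1};
-- and Xy ≠ 0 because every block is nonempty.
module Submission where

open import Defs
open import Data.Nat using (ℕ; zero; suc)
import Level
open import Data.Fin using (Fin; _≟_) renaming (zero to fzero; suc to fsuc)
open import Data.Fin.Properties using (suc-injective)
open import Data.Vec using (Vec; []; _∷_) renaming (map to vmap)
open import Data.Vec.Properties using (≡-dec; ∷-injective)
open import Data.List using (List; []; _∷_; _++_; concatMap; filter) renaming (map to lmap; foldr to lfoldr)
open import Data.List.Properties using (map-tabulate)
open import Data.Product using (_,_; proj₁; proj₂)
open import Relation.Nullary using (Dec; yes; no; ¬_; contradiction)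
open import Relation.Unary using (Pred; Decidable)
open import Relation.Binary.PropositionalEquality as ≡ using (_≡_)
open import Algebra.Bundles using (CommutativeSemiring)
open import Function using (_∘_; id)

_≟ᵛ_ : ∀ {m k} → (is js : Vec (Fin m) k) → Dec (is ≡ js)
_≟ᵛ_ = ≡-dec _≟_

module FiniteSums {c ℓ} (R : CommutativeSemiring c ℓ) where
  open CommutativeSemiring R
  open import Relation.Binary.Reasoning.Setoid setoid

  -- Σ over a list; definitionally the sum Σ[_]_ of Defs.
  ∑ : {A : Set} → List A → (A → Carrier) → Carrier
  ∑ xs f = lfoldr _+_ 0# (lmap f xs)

  ∑-cong : {A : Set} (xs : List A) {f g : A → Carrier} →
    (∀ x → f x ≈ g x) → ∑ xs f ≈ ∑ xs g
  ∑-cong []       f≈g = refl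
  ∑-cong (x ∷ xs) f≈g = +-cong (f≈g x) (∑-cong xs f≈g)

  ∑-zero : {A : Set} (xs : List A) → ∑ xs (λ _ → 0#) ≈ 0#
  ∑-zero []       = refl
  ∑-zero (x ∷ xs) = trans (+-identityˡ _) (∑-zero xs)

  ∑-++ : {A : Set} (xs ys : List A) (f : A → Carrier) →
    ∑ (xs ++ ys) f ≈ ∑ xs f + ∑ ys f
  ∑-++ []       ys f = sym (+-identityˡ _)
  ∑-++ (x ∷ xs) ys f = trans (+-congˡ (∑-++ xs ys f)) (sym (+-assoc _ _ _))

  ∑-concatMap : {A B : Set} (g : A → List B) (xs : List A) (f : B → Carrier) →
    ∑ (concatMap g xs) f ≈ ∑ xs (λ a → ∑ (g a) f)
  ∑-concatMap g []       f = refl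
  ∑-concatMap g (x ∷ xs) f =
    trans (∑-++ (g x) (concatMap g xs) f) (+-congˡ (∑-concatMap g xs f))

  ∑-map : {A B : Set} (h : A → B) (xs : List A) (f : B → Carrier) →
    ∑ (lmap h xs) f ≡ ∑ xs (f ∘ h)
  ∑-map h []       f = ≡.refl
  ∑-map h (x ∷ xs) f = ≡.cong (f (h x) +_) (∑-map h xs f)

  ∑-+ : {A : Set} (xs : List A) (f g : A → Carrier) →
    ∑ xs (λ x → f x + g x) ≈ ∑ xs f + ∑ xs g
  ∑-+ []       f g = sym (+-identityˡ _)
  ∑-+ (x ∷ xs) f g = begin
    (f x + g x) + ∑ xs (λ x → f x + g x) ≈⟨ +-congˡ (∑-+ xs f g) ⟩
    (f x + g x) + (∑ xs f + ∑ xs g)      ≈⟨ +-assoc (f x) (g x) _ ⟩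
    f x + (g x + (∑ xs f + ∑ xs g))      ≈⟨ +-congˡ (x+[y+z]≈y+[x+z] (g x) (∑ xs f) (∑ xs g)) ⟩
    f x + (∑ xs f + (g x + ∑ xs g))      ≈⟨ sym (+-assoc (f x) _ _) ⟩
    (f x + ∑ xs f) + (g x + ∑ xs g)      ∎
    where
    x+[y+z]≈y+[x+z] : ∀ a b d → a + (b + d) ≈ b + (a + d)
    x+[y+z]≈y+[x+z] a b d =
      trans (sym (+-assoc a b d)) (trans (+-congʳ (+-comm a b)) (+-assoc b a d))

  ∑-swap : {A B : Set} (xs : List A) (ys : List B) (f : A → B → Carrier) →
    ∑ xs (λ a → ∑ ys (f a)) ≈ ∑ ys (λ b → ∑ xs (λ a → f a b))
  ∑-swap []       ys f = sym (∑-zero ys)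
  ∑-swap (x ∷ xs) ys f =
    trans (+-congˡ (∑-swap xs ys f)) (sym (∑-+ ys (f x) _))

  ∑-*ʳ : {A : Set} (xs : List A) (f : A → Carrier) (a : Carrier) →
    ∑ xs f * a ≈ ∑ xs (λ x → f x * a)
  ∑-*ʳ []       f a = zeroˡ a
  ∑-*ʳ (x ∷ xs) f a = trans (distribʳ a _ _) (+-congˡ (∑-*ʳ xs f a))

  ∑-allFin-suc : (m : ℕ) (f : Fin (suc m) → Carrier) →
    ∑ (allFin (suc m)) f ≡ f fzero + ∑ (allFin m) (f ∘ fsuc)
  ∑-allFin-suc m f = ≡.cong (λ t → f fzero + lfoldr _+_ 0# t)
    (≡.trans (map-tabulate fsuc f) (≡.sym (map-tabulate id (f ∘ fsuc))))

  iverson : {Q : Set} → Dec Q → Carrier → Carrier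
  iverson (yes _) a = a
  iverson (no _)  a = 0#

  iverson-yes : {Q : Set} {a : Carrier} → Q → (d : Dec Q) → iverson d a ≡ a
  iverson-yes q (yes _) = ≡.refl
  iverson-yes q (no ¬q) = contradiction q ¬q

  iverson-no : {Q : Set} {a : Carrier} → ¬ Q → (d : Dec Q) → iverson d a ≡ 0#
  iverson-no ¬q (yes q) = contradiction q ¬q
  iverson-no ¬q (no _)  = ≡.refl

  iverson-⇔ : {Q Q′ : Set} {a : Carrier} → (Q → Q′) → (Q′ → Q) →
    (d : Dec Q) (d′ : Dec Q′) → iverson d a ≡ iverson d′ a
  iverson-⇔ to from (yes q) d′ = ≡.sym (iverson-yes (to q) d′)
  iverson-⇔ to from (no ¬q) d′ = ≡.sym (iverson-no (¬q ∘ from) d′)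

  iverson-cong : {Q : Set} (d : Dec Q) {a b : Carrier} → a ≈ b → iverson d a ≈ iverson d b
  iverson-cong (yes _) a≈b = a≈b
  iverson-cong (no _)  a≈b = refl

  ∑-iverson : {A Q : Set} (d : Dec Q) (xs : List A) (g : A → Carrier) →
    ∑ xs (λ x → iverson d (g x)) ≈ iverson d (∑ xs g)
  ∑-iverson (yes _) xs g = refl
  ∑-iverson (no _)  xs g = ∑-zero xs

  ∑-filter : {A : Set} {Q : Pred A Level.zero} (Q? : Decidable Q) (xs : List A)
    (f : A → Carrier) → ∑ (filter Q? xs) f ≈ ∑ xs (λ x → iverson (Q? x) (f x))
  ∑-filter Q? []       f = refl
  ∑-filter Q? (x ∷ xs) f with Q? x
  ... | yes _ = +-congˡ (∑-filter Q? xs f)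
  ... | no _  = trans (∑-filter Q? xs f) (sym (+-identityˡ _))

  ∑-kronecker : (m : ℕ) (v : Fin m) (f : Fin m → Carrier) →
    ∑ (allFin m) (λ i → iverson (v ≟ i) (f i)) ≈ f v
  ∑-kronecker (suc m) fzero f = begin
    ∑ (allFin (suc m)) (λ i → iverson (fzero ≟ i) (f i))
      ≡⟨ ∑-allFin-suc m _ ⟩
    f fzero + ∑ (allFin m) (λ i → iverson (fzero ≟ fsuc i) (f (fsuc i)))
      ≈⟨ +-congˡ (∑-cong (allFin m) (λ i → reflexive (iverson-no {a = f (fsuc i)} (λ ()) (fzero ≟ fsuc i)))) ⟩
    f fzero + ∑ (allFin m) (λ _ → 0#)
      ≈⟨ +-congˡ (∑-zero (allFin m)) ⟩
    f fzero + 0#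
      ≈⟨ +-identityʳ _ ⟩
    f fzero ∎
  ∑-kronecker (suc m) (fsuc v) f = begin
    ∑ (allFin (suc m)) (λ i → iverson (fsuc v ≟ i) (f i))
      ≡⟨ ∑-allFin-suc m _ ⟩
    0# + ∑ (allFin m) (λ i → iverson (fsuc v ≟ fsuc i) (f (fsuc i)))
      ≈⟨ +-identityˡ _ ⟩
    ∑ (allFin m) (λ i → iverson (fsuc v ≟ fsuc i) (f (fsuc i)))
      ≈⟨ ∑-cong (allFin m) (λ i → reflexive
           (iverson-⇔ suc-injective (≡.cong fsuc) (fsuc v ≟ fsuc i) (v ≟ i))) ⟩
    ∑ (allFin m) (λ i → iverson (v ≟ i) (f (fsuc i)))
      ≈⟨ ∑-kronecker m v (f ∘ fsuc) ⟩
    f (fsuc v) ∎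

  iverson-∷ : {m k : ℕ} (v i : Fin m) (vs is : Vec (Fin m) k) (a : Carrier) →
    iverson ((v ∷ vs) ≟ᵛ (i ∷ is)) a ≡ iverson (v ≟ i) (iverson (vs ≟ᵛ is) a)
  iverson-∷ v i vs is a = split (v ≟ i)
    where
    split : (d : Dec (v ≡ i)) →
      iverson ((v ∷ vs) ≟ᵛ (i ∷ is)) a ≡ iverson d (iverson (vs ≟ᵛ is) a)
    split (yes ≡.refl) =
      iverson-⇔ (proj₂ ∘ ∷-injective) (≡.cong (v ∷_)) ((v ∷ vs) ≟ᵛ (v ∷ is)) (vs ≟ᵛ is)
    split (no v≢i)     = iverson-no (v≢i ∘ proj₁ ∘ ∷-injective) ((v ∷ vs) ≟ᵛ (i ∷ is))

  -- Kronecker delta over all k-tuples: every tuple occurs exactly once.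
  ∑-kronecker-tuples : (k m : ℕ) (v : Vec (Fin m) k) (a : Carrier) →
    ∑ (allTuples k m) (λ is → iverson (v ≟ᵛ is) a) ≈ a
  ∑-kronecker-tuples zero    m []       a = +-identityʳ a
  ∑-kronecker-tuples (suc k) m (v ∷ vs) a = begin
    ∑ (concatMap (λ i → lmap (i ∷_) (allTuples k m)) (allFin m)) (λ is → iverson ((v ∷ vs) ≟ᵛ is) a)
      ≈⟨ ∑-concatMap _ (allFin m) _ ⟩
    ∑ (allFin m) (λ i → ∑ (lmap (i ∷_) (allTuples k m)) (λ is → iverson ((v ∷ vs) ≟ᵛ is) a))
      ≈⟨ ∑-cong (allFin m) (λ i → reflexive (∑-map (i ∷_) (allTuples k m) _)) ⟩
    ∑ (allFin m) (λ i → ∑ (allTuples k m) (λ is → iverson ((v ∷ vs) ≟ᵛ (i ∷ is)) a))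
      ≈⟨ ∑-cong (allFin m) (λ i → ∑-cong (allTuples k m) (λ is → reflexive (iverson-∷ v i vs is a))) ⟩
    ∑ (allFin m) (λ i → ∑ (allTuples k m) (λ is → iverson (v ≟ i) (iverson (vs ≟ᵛ is) a)))
      ≈⟨ ∑-cong (allFin m) (λ i → ∑-iverson (v ≟ i) (allTuples k m) _) ⟩
    ∑ (allFin m) (λ i → iverson (v ≟ i) (∑ (allTuples k m) (λ is → iverson (vs ≟ᵛ is) a)))
      ≈⟨ ∑-cong (allFin m) (λ i → iverson-cong (v ≟ i) (∑-kronecker-tuples k m vs a)) ⟩
    ∑ (allFin m) (λ i → iverson (v ≟ i) a)
      ≈⟨ ∑-kronecker m v (λ _ → a) ⟩
    a ∎

  -- Moving a factor inside a bracket [u = v], where v may be replaced by u.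
  iverson-*ʳ : {B : Set} {u v : B} (d : Dec (u ≡ v)) (b : Carrier) (F : B → Carrier) →
    iverson d b * F v ≈ iverson d (b * F u)
  iverson-*ʳ (yes ≡.refl) b F = refl
  iverson-*ʳ (no _)       b F = zeroˡ (F _)

  ∑-fibres : {A : Set} {k m : ℕ} (g : A → Vec (Fin m) k) (xs : List A)
    (h : A → Carrier) (F : Vec (Fin m) k → Carrier) →
    ∑ xs (λ a → h a * F (g a)) ≈
    ∑ (allTuples k m) (λ is → ∑ (filter (λ a → g a ≟ᵛ is) xs) h * F is)
  ∑-fibres {k = k} {m} g xs h F = sym (begin
    ∑ (allTuples k m) (λ is → ∑ (filter (λ a → g a ≟ᵛ is) xs) h * F is)
      ≈⟨ ∑-cong (allTuples k m) (λ is → *-congʳ (∑-filter (λ a → g a ≟ᵛ is) xs h)) ⟩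
    ∑ (allTuples k m) (λ is → ∑ xs (λ a → iverson (g a ≟ᵛ is) (h a)) * F is)
      ≈⟨ ∑-cong (allTuples k m) (λ is → ∑-*ʳ xs _ (F is)) ⟩
    ∑ (allTuples k m) (λ is → ∑ xs (λ a → iverson (g a ≟ᵛ is) (h a) * F is))
      ≈⟨ ∑-cong (allTuples k m) (λ is → ∑-cong xs (λ a → iverson-*ʳ (g a ≟ᵛ is) (h a) F)) ⟩
    ∑ (allTuples k m) (λ is → ∑ xs (λ a → iverson (g a ≟ᵛ is) (h a * F (g a))))
      ≈⟨ ∑-swap (allTuples k m) xs _ ⟩
    ∑ xs (λ a → ∑ (allTuples k m) (λ is → iverson (g a ≟ᵛ is) (h a * F (g a))))
      ≈⟨ ∑-cong xs (λ a → ∑-kronecker-tuples k m (g a) (h a * F (g a))) ⟩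
    ∑ xs (λ a → h a * F (g a)) ∎)

power-cong : ∀ {c ℓ} (𝔽 : CharZeroField c ℓ) {a b : CharZeroField.Carrier 𝔽} (e : ℕ) →
  CharZeroField._≈_ 𝔽 a b → CharZeroField._≈_ 𝔽 (_^_ 𝔽 a e) (_^_ 𝔽 b e)
power-cong 𝔽 zero    a≈b = CharZeroField.refl 𝔽
power-cong 𝔽 (suc e) a≈b = CharZeroField.*-cong 𝔽 a≈b (power-cong 𝔽 e a≈b)

module Lifting {c ℓ} (𝔽 : CharZeroField c ℓ) {n m : ℕ} (P : Partition n m) where
  open CharZeroField 𝔽
  open FiniteSums commutativeSemiring
  open Partition P
  open import Relation.Binary.Reasoning.Setoid setoid

  applyX-entry : (y : Vector 𝔽 m) (i : Fin n) → applyX 𝔽 P y i ≈ y (π i)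
  applyX-entry y i =
    trans (∑-cong (allFin m) row) (∑-kronecker m (π i) y)
    where
    row : ∀ j → charMatrix 𝔽 P i j * y j ≈ iverson (π i ≟ j) (y j)
    row j with π i ≟ j
    ... | yes _ = *-identityˡ (y j)
    ... | no _  = zeroˡ (y j)

  prodVec-applyX : ∀ {k} (y : Vector 𝔽 m) (js : Vec (Fin n) k) →
    prodVec 𝔽 (applyX 𝔽 P y) js ≈ prodVec 𝔽 y (vmap π js)
  prodVec-applyX y []       = refl
  prodVec-applyX y (j ∷ js) = *-cong (applyX-entry y j) (prodVec-applyX y js)

  -- y ≠ 0 implies Xy ≠ 0, since every block is nonempty (π is surjective).
  applyX-nonzero : (y : Vector 𝔽 m) → NonZero 𝔽 y → NonZero 𝔽 (applyX 𝔽 P y)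
  applyX-nonzero y y≢0 Xy≡0 = y≢0 λ j →
    let (i , πi≡j) = surj j in
    ≡.subst (λ t → y t ≈ 0#) (πi≡j ≡.refl) (trans (sym (applyX-entry y i)) (Xy≡0 i))

  apply-applyX : ∀ {k} (A : Tensor 𝔽 (suc k) n) (y : Vector 𝔽 m) (i : Fin n) →
    _·ᵗ_ 𝔽 A (applyX 𝔽 P y) i ≈
    ∑ (allTuples k m) (λ is → blockSum 𝔽 P A i is * prodVec 𝔽 y is)
  apply-applyX {k} A y i = begin
    ∑ (allTuples k n) (λ js → A (i ∷ js) * prodVec 𝔽 (applyX 𝔽 P y) js)
      ≈⟨ ∑-cong (allTuples k n) (λ js → *-congˡ (prodVec-applyX y js)) ⟩
    ∑ (allTuples k n) (λ js → A (i ∷ js) * prodVec 𝔽 y (vmap π js))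
      ≈⟨ ∑-fibres (vmap π) (allTuples k n) (λ js → A (i ∷ js)) (prodVec 𝔽 y) ⟩
    ∑ (allTuples k m) (λ is → blockSum 𝔽 P A i is * prodVec 𝔽 y is) ∎

  apply-applyX-equitable : ∀ {k} (A : Tensor 𝔽 (suc k) n) → IsEquitable 𝔽 P A →
    (y : Vector 𝔽 m) (i : Fin n) →
    _·ᵗ_ 𝔽 A (applyX 𝔽 P y) i ≈ _·ᵗ_ 𝔽 (quotientTensor 𝔽 P A) y (π i)
  apply-applyX-equitable {k} A equitable y i =
    trans (apply-applyX A y i)
      (∑-cong (allTuples k m) (λ is → *-congʳ (equitable (π i) is i ≡.refl)))

open Lifting

theorem3p3 : ∀ {c ℓ} (𝔽 : CharZeroField c ℓ) (k n m : ℕ)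
    (A : Tensor 𝔽 (suc k) n) (P : Partition n m) →
    IsEquitable 𝔽 P A →
    (λ' : CharZeroField.Carrier 𝔽) (y : Vector 𝔽 m) →
    IsHEigenpair 𝔽 (quotientTensor 𝔽 P A) λ' y →
    IsHEigenpair 𝔽 A λ' (applyX 𝔽 P y)
theorem3p3 𝔽 k n m A P equitable λ' y (y≢0 , eigen) =
  applyX-nonzero 𝔽 P y y≢0 , lifted-eigen
  where
  open CharZeroField 𝔽
  open import Relation.Binary.Reasoning.Setoid setoid
  open Partition P using (π)

  lifted-eigen : ∀ i → _·ᵗ_ 𝔽 A (applyX 𝔽 P y) i ≈ λ' * _^[_] 𝔽 (applyX 𝔽 P y) k i
  lifted-eigen i = begin
    _·ᵗ_ 𝔽 A (applyX 𝔽 P y) i               ≈⟨ apply-applyX-equitable 𝔽 P A equitable y i ⟩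
    _·ᵗ_ 𝔽 (quotientTensor 𝔽 P A) y (π i)   ≈⟨ eigen (π i) ⟩
    λ' * _^_ 𝔽 (y (π i)) k                   ≈⟨ *-congˡ (power-cong 𝔽 k (sym (applyX-entry 𝔽 P y i))) ⟩
    λ' * _^_ 𝔽 (applyX 𝔽 P y i) k            ∎
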